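{- Let the integer matrices $(a(i,j))_{i,j\ge1}$ and $(b(i,j))_{i,j\ge1}$ be defined as follows (all entries not specified, and all entries with an index $\le 0$, are $0$). For $1\le i\le 3$ the nonzero entries are: $(a(1,1),a(1,2),a(1,3))=(10,-36,27)$; $(a(2,1),\dots,a(2,6))=(-8,306,-2160,5508,-5832,2187)$; $(a(3,1),\dots,a(3,9))=(1,-360,10566,-99144,423549,-944784,1141614,-708588,177147)$; $(b(1,1),\dots,b(1,4))=(-9,252,-891,729)$; $(b(2,1),\dots,b(2,7))=(1,-378,8613,-54675,138510,-150903,59049)$; $(b(3,1),\dots,b(3,10))=(0,147,-14553,312255,-2617839,10764414,-23914845,29288304,-18600435,4782969)$. For $i\ge4$, both $m=a$ and $m=b$ satisfy $m(i,j)=30m(i-1,j-1)-108m(i-1,j-2)+81m(i-1,j-3)-12m(i-2,j-1)+9m(i-2,j-2)+m(i-3,j-1)$. Let $t(i,j)=\sum_{k\ge1}a(i,k)b(k,j)$ (a finite sum). Then for all $i,j\ge1$, $$\pi(t(i,j))\ge\min_{k\ge1}\{\pi(a(i,k))+\pi(b(k,j))\}\ge\min_{k\ge1}\left\{\left\lfloor\frac{3k-i-1}{2}\right\rfloor+\left\lfloor\frac{3j-k}{2}\right\rfloor\right\}.$$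
   Context: $\pi(n)$ denotes the $3$-adic order of an integer $n$, with $\pi(0)=\infty$; $\lfloor x\rfloor$ is the largest integer not exceeding $x$. -}

module Defs where

open import Data.Nat as ℕ using (ℕ; zero; suc)
open import Data.Nat.Divisibility using (_∣?_)
open import Data.Integer as ℤ using (ℤ; +_; -[1+_]; ∣_∣; _/ℕ_)
open import Data.Bool using (true; false)
open import Data.List using (List; []; _∷_)
open import Data.Product using (Σ; ∃; _×_)
open import Relation.Nullary using (yes; no)
open import Relation.Binary.PropositionalEquality using (_≡_)

-- Extended integers ℤ ∪ {∞}, used for 3-adic orders (π(0) = ∞).

data ℤ∞ : Set where
  fin : ℤ → ℤ∞
  ∞   : ℤ∞

infixl 6 _+∞_
_+∞_ : ℤ∞ → ℤ∞ → ℤ∞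
fin x +∞ fin y = fin (x ℤ.+ y)
fin x +∞ ∞     = ∞
∞     +∞ _     = ∞

infix 4 _≤∞_
data _≤∞_ : ℤ∞ → ℤ∞ → Set where
  fin≤fin : ∀ {x y} → x ℤ.≤ y → fin x ≤∞ fin y
  _≤∞∞    : ∀ x → x ≤∞ ∞

-- 3-adic order.
-- ord3ℕ fuel n : number of times 3 can be divided out of n (n > 0),
-- using at most `fuel` steps; fuel = n is always enough since 3^n > n.

ord3ℕ : ℕ → ℕ → ℕ
ord3ℕ zero     n = zero
ord3ℕ (suc f)  n with 3 ∣? n
... | yes _ = suc (ord3ℕ f (n ℕ./ 3))
... | no  _ = zero

π : ℤ → ℤ∞
π n with ∣ n ∣
... | zero  = ∞
... | suc m = fin (+ ord3ℕ (suc m) (suc m))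

-- Matrices indexed from 1; index 0 (i.e. ≤ 0) gives entry 0.

listAt : List ℤ → ℕ → ℤ
listAt xs       zero          = + 0
listAt []       (suc _)       = + 0
listAt (x ∷ xs) (suc zero)    = x
listAt (x ∷ xs) (suc (suc j)) = listAt xs (suc j)

shift : (ℕ → ℤ) → ℕ → ℕ → ℤ
shift r d j with j ℕ.≤ᵇ d
... | true  = + 0
... | false = r (j ℕ.∸ d)

-- m(i,j) = 30m(i-1,j-1) - 108m(i-1,j-2) + 81m(i-1,j-3)
--          - 12m(i-2,j-1) + 9m(i-2,j-2) + m(i-3,j-1)
-- with r1 = m(i-1,·), r2 = m(i-2,·), r3 = m(i-3,·).
recRow : (ℕ → ℤ) → (ℕ → ℤ) → (ℕ → ℤ) → ℕ → ℤ
recRow r1 r2 r3 j =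
  (+ 30) ℤ.* shift r1 1 j ℤ.- (+ 108) ℤ.* shift r1 2 j ℤ.+ (+ 81) ℤ.* shift r1 3 j
  ℤ.- (+ 12) ℤ.* shift r2 1 j ℤ.+ (+ 9) ℤ.* shift r2 2 j ℤ.+ shift r3 1 j

a : ℕ → ℕ → ℤ
a zero j = + 0
a (suc zero) = listAt (+ 10 ∷ ℤ.- + 36 ∷ + 27 ∷ [])
a (suc (suc zero)) = listAt (ℤ.- + 8 ∷ + 306 ∷ ℤ.- + 2160 ∷ + 5508 ∷ ℤ.- + 5832 ∷ + 2187 ∷ [])
a (suc (suc (suc zero))) = listAt (+ 1 ∷ ℤ.- + 360 ∷ + 10566 ∷ ℤ.- + 99144 ∷ + 423549
                                   ∷ ℤ.- + 944784 ∷ + 1141614 ∷ ℤ.- + 708588 ∷ + 177147 ∷ [])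
a (suc (suc (suc (suc n)))) = recRow (a (suc (suc (suc n)))) (a (suc (suc n))) (a (suc n))

b : ℕ → ℕ → ℤ
b zero j = + 0
b (suc zero) = listAt (ℤ.- + 9 ∷ + 252 ∷ ℤ.- + 891 ∷ + 729 ∷ [])
b (suc (suc zero)) = listAt (+ 1 ∷ ℤ.- + 378 ∷ + 8613 ∷ ℤ.- + 54675 ∷ + 138510
                             ∷ ℤ.- + 150903 ∷ + 59049 ∷ [])
b (suc (suc (suc zero))) = listAt (+ 0 ∷ + 147 ∷ ℤ.- + 14553 ∷ + 312255 ∷ ℤ.- + 2617839
                                   ∷ + 10764414 ∷ ℤ.- + 23914845 ∷ + 29288304
                                   ∷ ℤ.- + 18600435 ∷ + 4782969 ∷ [])
b (suc (suc (suc (suc n)))) = recRow (b (suc (suc (suc n)))) (b (suc (suc n))) (b (suc n))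

-- t(i,j) = Σ_{k ≥ 1} a(i,k) b(k,j).  Row i of a vanishes beyond column 3i
-- (rows 1..3 by inspection, and the recurrence raises the support by ≤ 3
-- per row), so the sum is taken over 1 ≤ k ≤ 3i.

sumFrom1 : ℕ → (ℕ → ℤ) → ℤ
sumFrom1 zero    f = + 0
sumFrom1 (suc n) f = sumFrom1 n f ℤ.+ f (suc n)

t : ℕ → ℕ → ℤ
t i j = sumFrom1 (3 ℕ.* i) (λ k → a i k ℤ.* b k j)

-- ⌊ x / 2 ⌋ for x ∈ ℤ (_/ℕ_ with positive divisor is floor division).
⌊_/2⌋ : ℤ → ℤ
⌊ x /2⌋ = x /ℕ 2

IsMinℤ∞ : (ℕ → ℤ∞) → ℤ∞ → Set
IsMinℤ∞ f m = (Σ ℕ λ k → (1 ℕ.≤ k) × (f k ≡ m)) × (∀ k → 1 ℕ.≤ k → m ≤∞ f k)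

IsMinℤ : (ℕ → ℤ) → ℤ → Set
IsMinℤ f m = (Σ ℕ λ k → (1 ℕ.≤ k) × (f k ≡ m)) × (∀ k → 1 ℕ.≤ k → m ℤ.≤ f k)

module Submission where

-- Say that a function f : ℕ → ℤ (a matrix row) is *valued with
-- weight w* if 3^u divides f c whenever 2u + w ≤ 3c.  Row i of a is valued
-- with weight i + 1 and row i of b with weight i: rows 1–3 are certified
-- entry by entry by computation, and the six-term recurrence raises the
-- weight by exactly 3 per row, because each coefficient carries enough
-- factors of 3 to pay for its column shift.  Since ⌊x/2⌋ ≥ u ⇔ 2u ≤ x, this
-- says π(a(i,k)) ≥ ⌊(3k-i-1)/2⌋ and π(b(k,j)) ≥ ⌊(3j-k)/2⌋.
--   The theorem then follows from general facts about π: π(x + y) is at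
-- least min(π x, π y) and π(xy) ≥ π x + π y, so π(t(i,j)) dominates the minimum
-- m₁ of π(a(i,k)) + π(b(k,j)); this minimum is attained on 1 ≤ k ≤ 3i + 1
-- because row i of a vanishes beyond column 3i; and the floor expression is
-- minimal at k = 1 (it grows with k), with value m₂ ≤ m₁.

open import Defs
open import Data.Nat as ℕ using (ℕ; zero; suc; z≤n; s≤s; _+_; _*_; _∸_; _^_; _≤_; _<_)
open import Data.Nat.DivMod using (_/_; m*n/n≡m; /-monoˡ-≤; m*[n/m]≡n)
open import Data.Nat.Divisibility as ℕ∣ using (_∣?_)
open import Data.Integer as ℤ using (ℤ; +_; -[1+_])
open import Data.Integer.Divisibility.Signed as ℤ∣ using (divides)
open import Data.Integer.DivMod using (a≡a%ℕn+[a/ℕn]*n; n%ℕd<d; _%ℕ_)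
open import Data.Product using (Σ; _×_; _,_; proj₁)
open import Data.Sum using (_⊎_; inj₁; inj₂)
open import Data.Bool using (true; false; T)
open import Data.Unit using (⊤)
open import Data.List using (List; []; _∷_; length)
open import Data.Empty using (⊥-elim)
open import Relation.Nullary using (yes; no)
open import Relation.Nullary.Decidable using (True; toWitness)
open import Relation.Binary.PropositionalEquality
import Data.Nat.Properties as ℕP
import Data.Integer.Properties as ℤP
import Data.Nat.Tactic.RingSolver as ℕRing
import Data.Integer.Tactic.RingSolver as ℤRing

infix 4 3^_∣_
3^_∣_ : ℕ → ℤ → Set
3^ u ∣ x = + (3 ^ u) ℤ∣.∣ x

3^∣0 : ∀ u → 3^ u ∣ + 0
3^∣0 u = divides (+ 0) refl

3^-mono-∣ : ∀ {u v} → u ≤ v → 3 ^ u ℕ∣.∣ 3 ^ v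
3^-mono-∣ {u} {v} u≤v = ℕ∣.divides (3 ^ (v ∸ u)) (begin
  3 ^ v                  ≡⟨ cong (3 ^_) (ℕP.m+[n∸m]≡n u≤v) ⟨
  3 ^ (u + (v ∸ u))      ≡⟨ ℕP.^-distribˡ-+-* 3 u (v ∸ u) ⟩
  3 ^ u * 3 ^ (v ∸ u)    ≡⟨ ℕP.*-comm (3 ^ u) _ ⟩
  3 ^ (v ∸ u) * 3 ^ u    ∎)
  where open ≡-Reasoning

3^∣-weaken : ∀ {u v x} → u ≤ v → 3^ v ∣ x → 3^ u ∣ x
3^∣-weaken u≤v = ℤ∣.∣-trans (ℤ∣.∣ᵤ⇒∣ (3^-mono-∣ u≤v))

3^∣-* : ∀ u v {x y} → 3^ u ∣ x → 3^ v ∣ y → 3^ (u + v) ∣ x ℤ.* y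
3^∣-* u v {x} {y} u∣x v∣y =
  subst (ℤ∣._∣ x ℤ.* y) power (ℤ∣.∣-trans (ℤ∣.*-monoˡ-∣ (+ (3 ^ v)) u∣x) (ℤ∣.*-monoʳ-∣ x v∣y))
  where
  power : + (3 ^ u) ℤ.* + (3 ^ v) ≡ + (3 ^ (u + v))
  power = trans (sym (ℤP.pos-* (3 ^ u) (3 ^ v))) (cong +_ (sym (ℕP.^-distribˡ-+-* 3 u v)))

ord3ℕ-divides : ∀ f n → 3 ^ ord3ℕ f n ℕ∣.∣ n
ord3ℕ-divides zero n = ℕ∣.1∣ n
ord3ℕ-divides (suc f) n with 3 ∣? n
... | yes 3∣n = subst (λ m → 3 * 3 ^ ord3ℕ f (n / 3) ℕ∣.∣ m) (m*[n/m]≡n 3∣n)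
                      (ℕ∣.*-monoʳ-∣ 3 (ord3ℕ-divides f (n / 3)))
... | no _ = ℕ∣.1∣ n

ord3ℕ-maximal : ∀ f n u → 3 ^ u ℕ∣.∣ n → u ≤ f → u ≤ ord3ℕ f n
ord3ℕ-maximal f n zero _ _ = z≤n
ord3ℕ-maximal (suc f) n (suc u) 3^u∣n (s≤s u≤f) with 3 ∣? n
... | yes 3∣n = s≤s (ord3ℕ-maximal f (n / 3) u (ℕ∣.*-cancelˡ-∣ 3 3^u∣3[n/3]) u≤f)
  where
  3^u∣3[n/3] : 3 * 3 ^ u ℕ∣.∣ 3 * (n / 3)
  3^u∣3[n/3] = subst (3 * 3 ^ u ℕ∣.∣_) (sym (m*[n/m]≡n 3∣n)) 3^u∣n
... | no 3∤n = ⊥-elim (3∤n (ℕ∣.∣-trans (ℕ∣.m∣m*n (3 ^ u)) 3^u∣n))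

-- The fuel n used by π suffices, since 3^u ≤ n whenever 3^u divides n > 0.
u<3^u : ∀ u → u < 3 ^ u
u<3^u zero = s≤s z≤n
u<3^u (suc u) = ℕP.≤-trans (ℕP.+-mono-≤ (ℕP.m^n>0 3 u) (u<3^u u))
                           (ℕP.+-monoʳ-≤ (3 ^ u) (ℕP.m≤m+n (3 ^ u) _))

ord3ℕ-maximal-nonzero : ∀ m u → 3 ^ u ℕ∣.∣ suc m → u ≤ ord3ℕ (suc m) (suc m)
ord3ℕ-maximal-nonzero m u d =
  ord3ℕ-maximal (suc m) (suc m) u d (ℕP.≤-trans (ℕP.<⇒≤ (u<3^u u)) (ℕ∣.∣⇒≤ d))

data Order3 (x : ℤ) : Set where
  infinite : x ≡ + 0 → π x ≡ ∞ → Order3 x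
  exact    : ∀ v → π x ≡ fin (+ v) → 3^ v ∣ x → (∀ u → 3^ u ∣ x → u ≤ v) → Order3 x

order3 : ∀ x → Order3 x
order3 (+ zero)  = infinite refl refl
order3 (+ suc m) = exact _ refl (ℤ∣.∣ᵤ⇒∣ (ord3ℕ-divides (suc m) (suc m)))
                         (λ u d → ord3ℕ-maximal-nonzero m u (ℤ∣.∣⇒∣ᵤ d))
order3 -[1+ m ]  = exact _ refl (ℤ∣.∣ᵤ⇒∣ (ord3ℕ-divides (suc m) (suc m)))
                         (λ u d → ord3ℕ-maximal-nonzero m u (ℤ∣.∣⇒∣ᵤ d))

π-≥-from-∣ : ∀ x u → 3^ u ∣ x → fin (+ u) ≤∞ π x
π-≥-from-∣ x u d with order3 x
... | infinite _ πx≡∞ rewrite πx≡∞ = _ ≤∞∞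
... | exact v πx≡v _ maximal rewrite πx≡v = fin≤fin (ℤ.+≤+ (maximal u d))

∣-from-π-≥ : ∀ x u → fin (+ u) ≤∞ π x → 3^ u ∣ x
∣-from-π-≥ x u u≤πx with order3 x
... | infinite x≡0 _ rewrite x≡0 = 3^∣0 u
... | exact v πx≡v v∣x _ rewrite πx≡v with u≤πx
...   | fin≤fin (ℤ.+≤+ u≤v) = 3^∣-weaken u≤v v∣x

negative-≤-π : ∀ n x → fin -[1+ n ] ≤∞ π x
negative-≤-π n x with order3 x
... | infinite _ πx≡∞ rewrite πx≡∞ = _ ≤∞∞
... | exact _ πx≡v _ _ rewrite πx≡v = fin≤fin ℤ.-≤+

∞-≤-π : ∀ x → ∞ ≤∞ π x → x ≡ + 0
∞-≤-π x ∞≤πx with order3 x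
... | infinite x≡0 _ = x≡0
... | exact _ πx≡v _ _ rewrite πx≡v with ∞≤πx
...   | ()

π-+ : ∀ w x y → w ≤∞ π x → w ≤∞ π y → w ≤∞ π (x ℤ.+ y)
π-+ ∞ x y w≤πx w≤πy rewrite ∞-≤-π x w≤πx | ∞-≤-π y w≤πy = _ ≤∞∞
π-+ (fin (+ u)) x y w≤πx w≤πy =
  π-≥-from-∣ _ u (ℤ∣.∣m∣n⇒∣m+n (∣-from-π-≥ x u w≤πx) (∣-from-π-≥ y u w≤πy))
π-+ (fin -[1+ n ]) x y _ _ = negative-≤-π n (x ℤ.+ y)

π-* : ∀ w x y → w ≤∞ π x +∞ π y → w ≤∞ π (x ℤ.* y)
π-* w x y w≤ with order3 x
... | infinite x≡0 _ rewrite x≡0 = _ ≤∞∞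
... | exact v πx≡v v∣x _ with order3 y
...   | infinite y≡0 _ rewrite y≡0 | ℤP.*-zeroʳ x = _ ≤∞∞
...   | exact v′ πy≡v′ v′∣y _ rewrite πx≡v | πy≡v′ with w | w≤
...     | fin (+ u)    | fin≤fin (ℤ.+≤+ u≤v+v′) = π-≥-from-∣ _ u (3^∣-weaken u≤v+v′ (3^∣-* v v′ v∣x v′∣y))
...     | fin -[1+ n ] | _ = negative-≤-π n (x ℤ.* y)

≤∞-refl : ∀ x → x ≤∞ x
≤∞-refl (fin x) = fin≤fin ℤP.≤-refl
≤∞-refl ∞ = ∞ ≤∞∞

≤∞-trans : ∀ {x y z} → x ≤∞ y → y ≤∞ z → x ≤∞ z
≤∞-trans (fin≤fin p) (fin≤fin q) = fin≤fin (ℤP.≤-trans p q)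
≤∞-trans _ (_ ≤∞∞) = _ ≤∞∞

+∞-mono : ∀ {x y p q} → fin x ≤∞ p → fin y ≤∞ q → fin (x ℤ.+ y) ≤∞ p +∞ q
+∞-mono (fin≤fin x≤p) (fin≤fin y≤q) = fin≤fin (ℤP.+-mono-≤ x≤p y≤q)
+∞-mono (fin≤fin _) (_ ≤∞∞) = _ ≤∞∞
+∞-mono (_ ≤∞∞) _ = _ ≤∞∞

min∞ : ℤ∞ → ℤ∞ → ℤ∞
min∞ ∞ y = y
min∞ (fin x) ∞ = fin x
min∞ (fin x) (fin y) with x ℤP.≤? y
... | yes _ = fin x
... | no _  = fin y

min∞-≤ˡ : ∀ x y → min∞ x y ≤∞ x
min∞-≤ˡ ∞ y = y ≤∞∞
min∞-≤ˡ (fin x) ∞ = ≤∞-refl _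
min∞-≤ˡ (fin x) (fin y) with x ℤP.≤? y
... | yes _ = ≤∞-refl _
... | no x≰y = fin≤fin (ℤP.<⇒≤ (ℤP.≰⇒> x≰y))

min∞-≤ʳ : ∀ x y → min∞ x y ≤∞ y
min∞-≤ʳ ∞ y = ≤∞-refl _
min∞-≤ʳ (fin x) ∞ = _ ≤∞∞
min∞-≤ʳ (fin x) (fin y) with x ℤP.≤? y
... | yes x≤y = fin≤fin x≤y
... | no _ = ≤∞-refl _

min∞-sel : ∀ x y → min∞ x y ≡ x ⊎ min∞ x y ≡ y
min∞-sel ∞ y = inj₂ refl
min∞-sel (fin x) ∞ = inj₁ refl
min∞-sel (fin x) (fin y) with x ℤP.≤? y
... | yes _ = inj₁ refl
... | no _  = inj₂ refl

prefixMin : (ℕ → ℤ∞) → ℕ → ℤ∞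
prefixMin f zero = f 1
prefixMin f (suc n) = min∞ (prefixMin f n) (f (2 + n))

prefixMin-attained : ∀ f n → Σ ℕ λ k → (1 ≤ k) × (f k ≡ prefixMin f n)
prefixMin-attained f zero = 1 , s≤s z≤n , refl
prefixMin-attained f (suc n) with min∞-sel (prefixMin f n) (f (2 + n))
... | inj₁ min≡old = let (k , 1≤k , fk≡) = prefixMin-attained f n in k , 1≤k , trans fk≡ (sym min≡old)
... | inj₂ min≡new = 2 + n , s≤s z≤n , sym min≡new

prefixMin-≤ : ∀ f n k → 1 ≤ k → k ≤ suc n → prefixMin f n ≤∞ f k
prefixMin-≤ f zero .1 (s≤s z≤n) (s≤s z≤n) = ≤∞-refl _
prefixMin-≤ f (suc n) k 1≤k k≤2+n with ℕP.m≤n⇒m<n∨m≡n k≤2+n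
... | inj₁ (s≤s k≤1+n) = ≤∞-trans (min∞-≤ˡ (prefixMin f n) (f (2 + n))) (prefixMin-≤ f n k 1≤k k≤1+n)
... | inj₂ refl = min∞-≤ʳ (prefixMin f n) (f (2 + n))

⌊/2⌋-lower : ∀ x → ⌊ x /2⌋ ℤ.* + 2 ℤ.≤ x
⌊/2⌋-lower x = subst (⌊ x /2⌋ ℤ.* + 2 ℤ.≤_) (sym (a≡a%ℕn+[a/ℕn]*n x 2))
                     (ℤP.i≤j+i _ (+ (x %ℕ 2)))

⌊/2⌋-upper : ∀ x → x ℤ.≤ ⌊ x /2⌋ ℤ.* + 2 ℤ.+ + 1
⌊/2⌋-upper x = begin
  x                              ≡⟨ a≡a%ℕn+[a/ℕn]*n x 2 ⟩
  + (x %ℕ 2) ℤ.+ ⌊ x /2⌋ ℤ.* + 2  ≤⟨ ℤP.+-monoˡ-≤ (⌊ x /2⌋ ℤ.* + 2) (ℤ.+≤+ (ℕP.≤-pred (n%ℕd<d x 2))) ⟩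
  + 1 ℤ.+ ⌊ x /2⌋ ℤ.* + 2         ≡⟨ ℤP.+-comm (+ 1) (⌊ x /2⌋ ℤ.* + 2) ⟩
  ⌊ x /2⌋ ℤ.* + 2 ℤ.+ + 1         ∎
  where open ℤP.≤-Reasoning

⌊/2⌋-sum-mono : ∀ x y x′ y′ → x ℤ.+ y ℤ.≤ x′ ℤ.+ y′ ℤ.- + 2 →
                ⌊ x /2⌋ ℤ.+ ⌊ y /2⌋ ℤ.≤ ⌊ x′ /2⌋ ℤ.+ ⌊ y′ /2⌋
⌊/2⌋-sum-mono x y x′ y′ gap = ℤP.*-cancelʳ-≤-pos _ _ (+ 2) (begin
  (q ℤ.+ r) ℤ.* + 2                               ≡⟨ ℤP.*-distribʳ-+ (+ 2) q r ⟩
  q ℤ.* + 2 ℤ.+ r ℤ.* + 2                         ≤⟨ ℤP.+-mono-≤ (⌊/2⌋-lower x) (⌊/2⌋-lower y) ⟩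
  x ℤ.+ y                                         ≤⟨ gap ⟩
  x′ ℤ.+ y′ ℤ.- + 2                               ≤⟨ ℤP.+-monoˡ-≤ _ (ℤP.+-mono-≤ (⌊/2⌋-upper x′) (⌊/2⌋-upper y′)) ⟩
  (q′ ℤ.* + 2 ℤ.+ + 1) ℤ.+ (r′ ℤ.* + 2 ℤ.+ + 1) ℤ.- + 2 ≡⟨ regroup q′ r′ ⟩
  (q′ ℤ.+ r′) ℤ.* + 2                             ∎)
  where
  open ℤP.≤-Reasoning
  q r q′ r′ : ℤ
  q = ⌊ x /2⌋
  r = ⌊ y /2⌋
  q′ = ⌊ x′ /2⌋
  r′ = ⌊ y′ /2⌋
  regroup : ∀ A B → (A ℤ.* + 2 ℤ.+ + 1) ℤ.+ (B ℤ.* + 2 ℤ.+ + 1) ℤ.- + 2 ≡ (A ℤ.+ B) ℤ.* + 2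
  regroup = ℤRing.solve-∀

π-≥-⌊/2⌋ : ∀ x c → (∀ u → + (u * 2) ℤ.≤ x → 3^ u ∣ c) → fin ⌊ x /2⌋ ≤∞ π c
π-≥-⌊/2⌋ x c divisible with ⌊ x /2⌋ | ⌊/2⌋-lower x
... | + u      | 2u≤x = π-≥-from-∣ c u (divisible u (subst (ℤ._≤ x) (sym (ℤP.pos-* u 2)) 2u≤x))
... | -[1+ n ] | _    = negative-≤-π n c

Valued : ℕ → (ℕ → ℤ) → Set
Valued w f = ∀ c u → u * 2 + w ≤ 3 * c → 3^ u ∣ f c

-- The inequality behind valued-shift, after writing u = v + u′, c = d + c′.
shift-arith : ∀ r n d v w u′ c′ → (v + u′) * 2 + (n + w) ≤ 3 * (d + c′) →
              r + 3 * d ≤ n + v * 2 → u′ * 2 + (r + w) ≤ 3 * c′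
shift-arith r n d v w u′ c′ big cost = ℕP.+-cancelʳ-≤ (n + v * 2 + 3 * d) _ _ (begin
  u′ * 2 + (r + w) + (n + v * 2 + 3 * d)    ≡⟨ regroupˡ r n d v w u′ ⟩
  ((v + u′) * 2 + (n + w)) + (r + 3 * d)    ≤⟨ ℕP.+-mono-≤ big cost ⟩
  3 * (d + c′) + (n + v * 2)                ≡⟨ regroupʳ n d v c′ ⟩
  3 * c′ + (n + v * 2 + 3 * d)              ∎)
  where
  open ℕP.≤-Reasoning
  regroupˡ : ∀ r n d v w u′ → u′ * 2 + (r + w) + (n + v * 2 + 3 * d) ≡ ((v + u′) * 2 + (n + w)) + (r + 3 * d)
  regroupˡ = ℕRing.solve-∀
  regroupʳ : ∀ n d v c′ → 3 * (d + c′) + (n + v * 2) ≡ 3 * c′ + (n + v * 2 + 3 * d)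
  regroupʳ = ℕRing.solve-∀

-- A shifted row κ·f(c - d) gains weight n - r, provided the factor 3^v of κ
-- pays for the column shift: r + 3d ≤ n + 2v.
valued-shift : ∀ r n d v {w κ f} → 3^ v ∣ κ → r + 3 * d ≤ n + v * 2 →
               Valued (r + w) f → Valued (n + w) (λ c → κ ℤ.* shift f d c)
valued-shift r n d v {w} {κ} {f} v∣κ cost valued c u big with c ℕ.≤ᵇ d in c≤ᵇd
... | true = ℤ∣.∣n⇒∣m*n κ (3^∣0 u)
... | false with u ℕ.≤? v
...   | yes u≤v = ℤ∣.∣m⇒∣m*n (f (c ∸ d)) (3^∣-weaken u≤v v∣κ)
...   | no u≰v = subst (λ e → 3^ e ∣ κ ℤ.* f (c ∸ d)) (ℕP.m+[n∸m]≡n v≤u)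
                   (3^∣-* v (u ∸ v) v∣κ (valued (c ∸ d) (u ∸ v) (shift-arith r n d v w (u ∸ v) (c ∸ d) big′ cost)))
  where
  v≤u : v ≤ u
  v≤u = ℕP.≰⇒≥ u≰v
  d≤c : d ≤ c
  d≤c = ℕP.<⇒≤ (ℕP.≰⇒> (λ c≤d → subst T c≤ᵇd (ℕP.≤⇒≤ᵇ c≤d)))
  big′ : (v + (u ∸ v)) * 2 + (n + w) ≤ 3 * (d + (c ∸ d))
  big′ = subst₂ (λ u c → u * 2 + (n + w) ≤ 3 * c) (sym (ℕP.m+[n∸m]≡n v≤u)) (sym (ℕP.m+[n∸m]≡n d≤c)) big

-- The recurrence raises the weight by 3: the coefficients 30, 108, 81, 12, 9, 1
-- are divisible by 3^1, 3^3, 3^4, 3^1, 3^2, 3^0.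
valued-recRow : ∀ {w f₁ f₂ f₃} → Valued (2 + w) f₁ → Valued (1 + w) f₂ → Valued w f₃ →
                Valued (3 + w) (recRow f₁ f₂ f₃)
valued-recRow {f₃ = f₃} v₁ v₂ v₃ c u big =
  ℤ∣.∣m∣n⇒∣m+n (ℤ∣.∣m∣n⇒∣m+n (ℤ∣.∣m∣n⇒∣m-n (ℤ∣.∣m∣n⇒∣m+n (ℤ∣.∣m∣n⇒∣m-n
    (valued-shift 2 3 1 1 (divides (+ 10) refl) ℕP.≤-refl v₁ c u big)
    (valued-shift 2 3 2 3 (divides (+ 4) refl) (ℕP.n≤1+n 8) v₁ c u big))
    (valued-shift 2 3 3 4 (divides (+ 1) refl) ℕP.≤-refl v₁ c u big))
    (valued-shift 1 3 1 1 (divides (+ 4) refl) (ℕP.n≤1+n 4) v₂ c u big))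
    (valued-shift 1 3 2 2 (divides (+ 1) refl) ℕP.≤-refl v₂ c u big))
    (subst (3^ u ∣_) (ℤP.*-identityˡ (shift f₃ 1 c))
      (valued-shift 0 3 1 0 (divides (+ 1) refl) ℕP.≤-refl v₃ c u big))

-- Certificate, decidable by computation, that a listed row (starting at
-- column c₀) is valued with weight w: its entry in column c is divisible
-- by 3^⌊(3c - w)/2⌋.
Certified : ℕ → ℕ → List ℤ → Set
Certified w c₀ [] = ⊤
Certified w c₀ (x ∷ xs) = True (3 ^ ((3 * c₀ ∸ w) / 2) ∣? ℤ.∣ x ∣) × Certified w (suc c₀) xs

halve-bound : ∀ u w m → u * 2 + w ≤ m → u ≤ (m ∸ w) / 2
halve-bound u w m big =
  subst (_≤ (m ∸ w) / 2) (m*n/n≡m u 2) (/-monoˡ-≤ 2 (ℕP.m+n≤o⇒m≤o∸n (u * 2) big))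

certified-entries : ∀ w c₀ xs → Certified w c₀ xs →
                    ∀ j u → u * 2 + w ≤ 3 * (c₀ + j) → 3^ u ∣ listAt xs (suc j)
certified-entries w c₀ [] _ j u _ = 3^∣0 u
certified-entries w c₀ (x ∷ xs) (x✓ , _) zero u big =
  3^∣-weaken (halve-bound u w (3 * c₀) (subst (λ c → u * 2 + w ≤ 3 * c) (ℕP.+-identityʳ c₀) big))
             (ℤ∣.∣ᵤ⇒∣ (toWitness x✓))
certified-entries w c₀ (x ∷ xs) (_ , xs✓) (suc j) u big =
  certified-entries w (suc c₀) xs xs✓ j u (subst (λ c → u * 2 + w ≤ 3 * c) (ℕP.+-suc c₀ j) big)

certified-valued : ∀ w xs → Certified w 1 xs → Valued w (listAt xs)
certified-valued w xs _ zero u _ = 3^∣0 u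
certified-valued w xs xs✓ (suc j) = certified-entries w 1 xs xs✓ j

three-step-induction : (P : ℕ → Set) → P 1 → P 2 → P 3 →
                       (∀ n → P (1 + n) → P (2 + n) → P (3 + n) → P (4 + n)) → ∀ n → P (suc n)
three-step-induction P p₁ p₂ p₃ step n = proj₁ (window n)
  where
  window : ∀ n → P (1 + n) × P (2 + n) × P (3 + n)
  window zero = p₁ , p₂ , p₃
  window (suc n) = let (q₁ , q₂ , q₃) = window n in q₂ , q₃ , step n q₁ q₂ q₃

a-valued : ∀ i → Valued (suc i) (a i)
a-valued zero c u _ = 3^∣0 u
a-valued (suc i) = three-step-induction (λ i → Valued (suc i) (a i))
  (certified-valued 2 _ _) (certified-valued 3 _ _) (certified-valued 4 _ _)
  (λ n v₁ v₂ v₃ → valued-recRow v₃ v₂ v₁) i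

b-valued : ∀ i → Valued i (b i)
b-valued zero c u _ = 3^∣0 u
b-valued (suc i) = three-step-induction (λ i → Valued i (b i))
  (certified-valued 1 _ _) (certified-valued 2 _ _) (certified-valued 3 _ _)
  (λ n v₁ v₂ v₃ → valued-recRow v₃ v₂ v₁) i

-- Supported N f: f vanishes beyond column N.  Row i of a is supported in
-- columns ≤ 3i, which makes the minimum over k ≥ 1 a finite one.
Supported : ℕ → (ℕ → ℤ) → Set
Supported N f = ∀ c → N < c → f c ≡ + 0

listAt-supported : ∀ xs → Supported (length xs) (listAt xs)
listAt-supported xs zero _ = refl
listAt-supported [] (suc c) _ = refl
listAt-supported (x ∷ xs) (suc zero) (s≤s ())
listAt-supported (x ∷ xs) (suc (suc c)) (s≤s len<c) = listAt-supported xs (suc c) len<c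

supported-shift : ∀ d e {R f} → Supported R f → Supported (d + e + R) (shift f d)
supported-shift d e {R} supp c big with c ℕ.≤ᵇ d
... | true  = refl
... | false = supp (c ∸ d) (ℕP.m+n≤o⇒m≤o∸n (suc R) (ℕP.≤-trans (s≤s R+d≤d+e+R) big))
  where
  R+d≤d+e+R : R + d ≤ d + e + R
  R+d≤d+e+R = ℕP.≤-trans (ℕP.≤-reflexive (ℕP.+-comm R d)) (ℕP.+-monoˡ-≤ R (ℕP.m≤m+n d e))

supported-recRow : ∀ {s f₁ f₂ f₃} → Supported (6 + s) f₁ → Supported (3 + s) f₂ → Supported s f₃ →
                   Supported (9 + s) (recRow f₁ f₂ f₃)
supported-recRow s₁ s₂ s₃ c big
  rewrite supported-shift 1 2 s₁ c big | supported-shift 2 1 s₁ c big | supported-shift 3 0 s₁ c big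
        | supported-shift 1 5 s₂ c big | supported-shift 2 4 s₂ c big | supported-shift 1 8 s₃ c big
  = refl

a-supported : ∀ i → Supported (i * 3) (a i)
a-supported zero c _ = refl
a-supported (suc i) = three-step-induction (λ i → Supported (i * 3) (a i))
  (listAt-supported _) (listAt-supported _) (listAt-supported _)
  (λ n s₁ s₂ s₃ → supported-recRow s₃ s₂ s₁) i

ℤ-gap⇒ℕ : ∀ m n p → + m ℤ.≤ + n ℤ.- + p → m + p ≤ n
ℤ-gap⇒ℕ m n p m≤n-p = ℤP.drop‿+≤+ (subst (+ (m + p) ℤ.≤_) (cancel (+ n) (+ p))
                                      (ℤP.+-monoˡ-≤ (+ p) m≤n-p))
  where
  cancel : ∀ N P → N ℤ.- P ℤ.+ P ≡ N
  cancel = ℤRing.solve-∀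

floorBound : ℕ → ℕ → ℕ → ℤ
floorBound i j k = ⌊ (+ (3 * k)) ℤ.- (+ i) ℤ.- (+ 1) /2⌋ ℤ.+ ⌊ (+ (3 * j)) ℤ.- (+ k) /2⌋

floorBound-≤ : ∀ i j k → fin (floorBound i j k) ≤∞ π (a i k) +∞ π (b k j)
floorBound-≤ i j k = +∞-mono (π-≥-⌊/2⌋ _ _ a-bound) (π-≥-⌊/2⌋ _ _ b-bound)
  where
  a-bound : ∀ u → + (u * 2) ℤ.≤ + (3 * k) ℤ.- + i ℤ.- + 1 → 3^ u ∣ a i k
  a-bound u 2u≤ = a-valued i k u
    (ℤ-gap⇒ℕ (u * 2) (3 * k) (suc i) (subst (+ (u * 2) ℤ.≤_) (regroup (+ (3 * k)) (+ i)) 2u≤))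
    where
    regroup : ∀ K I → K ℤ.- I ℤ.- + 1 ≡ K ℤ.- (+ 1 ℤ.+ I)
    regroup = ℤRing.solve-∀
  b-bound : ∀ u → + (u * 2) ℤ.≤ + (3 * j) ℤ.- + k → 3^ u ∣ b k j
  b-bound u 2u≤ = b-valued k j u (ℤ-gap⇒ℕ (u * 2) (3 * j) k 2u≤)

floorBound-min : ∀ i j k → 1 ≤ k → floorBound i j 1 ℤ.≤ floorBound i j k
floorBound-min i j (suc zero) _ = ℤP.≤-refl
floorBound-min i j (suc (suc k)) _ = ⌊/2⌋-sum-mono x₁ y₁ x₂ y₂ (begin
  x₁ ℤ.+ y₁                       ≤⟨ ℤP.i≤i+j _ (+ (2 * k)) ⟩
  x₁ ℤ.+ y₁ ℤ.+ + (2 * k)          ≡⟨ cong (λ z → x₁ ℤ.+ y₁ ℤ.+ z) (ℤP.pos-* 2 k) ⟩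
  x₁ ℤ.+ y₁ ℤ.+ + 2 ℤ.* + k        ≡⟨ regroup (+ i) (+ (3 * j)) (+ k) ⟩
  + 3 ℤ.* (+ 2 ℤ.+ + k) ℤ.- + i ℤ.- + 1 ℤ.+ y₂ ℤ.- + 2
                                  ≡⟨ cong (λ z → z ℤ.- + i ℤ.- + 1 ℤ.+ y₂ ℤ.- + 2) (sym (ℤP.pos-* 3 (2 + k))) ⟩
  x₂ ℤ.+ y₂ ℤ.- + 2               ∎)
  where
  open ℤP.≤-Reasoning
  x₁ y₁ x₂ y₂ : ℤ
  x₁ = + 3 ℤ.- + i ℤ.- + 1
  y₁ = + (3 * j) ℤ.- + 1
  x₂ = + (3 * (2 + k)) ℤ.- + i ℤ.- + 1
  y₂ = + (3 * j) ℤ.- + (2 + k)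
  regroup : ∀ I J K → (+ 3 ℤ.- I ℤ.- + 1) ℤ.+ (J ℤ.- + 1) ℤ.+ + 2 ℤ.* K
                      ≡ + 3 ℤ.* (+ 2 ℤ.+ K) ℤ.- I ℤ.- + 1 ℤ.+ (J ℤ.- (+ 2 ℤ.+ K)) ℤ.- + 2
  regroup = ℤRing.solve-∀

π-sum : ∀ w (f : ℕ → ℤ) n → (∀ k → 1 ≤ k → k ≤ n → w ≤∞ π (f k)) → w ≤∞ π (sumFrom1 n f)
π-sum w f zero _ = _ ≤∞∞
π-sum w f (suc n) bound = π-+ w (sumFrom1 n f) (f (suc n)) (π-sum w f n (λ k 1≤k k≤n → bound k 1≤k (ℕP.m≤n⇒m≤1+n k≤n)))
                                    (bound (suc n) (s≤s z≤n) ℕP.≤-refl)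

corollary3p2 : (i j : ℕ) → 1 ℕ.≤ i → 1 ℕ.≤ j →
    Σ ℤ∞ λ m₁ → Σ ℤ λ m₂ →
      IsMinℤ∞ (λ k → π (a i k) +∞ π (b k j)) m₁
      × IsMinℤ (λ k → ⌊ (+ (3 ℕ.* k)) ℤ.- (+ i) ℤ.- (+ 1) /2⌋ ℤ.+ ⌊ (+ (3 ℕ.* j)) ℤ.- (+ k) /2⌋) m₂
      × m₁ ≤∞ π (t i j)
      × fin m₂ ≤∞ m₁
corollary3p2 i j _ _ =
  m₁ , floorBound i j 1 , (attained , m₁-≤) , ((1 , s≤s z≤n , refl) , floorBound-min i j)
  , π-sum m₁ _ (3 * i) (λ k 1≤k k≤3i → π-* m₁ (a i k) (b k j) (prefixMin-≤ F (3 * i) k 1≤k (ℕP.m≤n⇒m≤1+n k≤3i)))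
  , m₂-≤
  where
  -- m₁ is the minimum of F over 1 ≤ k ≤ 3i + 1; beyond 3i, a(i,k) = 0 and F k = ∞.
  F : ℕ → ℤ∞
  F k = π (a i k) +∞ π (b k j)
  m₁ : ℤ∞
  m₁ = prefixMin F (3 * i)
  attained : Σ ℕ λ k → (1 ≤ k) × (F k ≡ m₁)
  attained = prefixMin-attained F (3 * i)
  m₁-≤ : ∀ k → 1 ≤ k → m₁ ≤∞ F k
  m₁-≤ k 1≤k with k ℕ.≤? suc (3 * i)
  ... | yes k≤3i+1 = prefixMin-≤ F (3 * i) k 1≤k k≤3i+1
  ... | no k≰3i+1 rewrite a-supported i k (subst (_< k) (ℕP.*-comm 3 i) (ℕP.<⇒≤ (ℕP.≰⇒> k≰3i+1))) = m₁ ≤∞∞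
  m₂-≤ : fin (floorBound i j 1) ≤∞ m₁
  m₂-≤ = let (k , 1≤k , Fk≡m₁) = attained in
         subst (fin (floorBound i j 1) ≤∞_) Fk≡m₁
               (≤∞-trans (fin≤fin (floorBound-min i j k 1≤k)) (floorBound-≤ i j k))
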